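{- For every $n\ge 1$, $\mathrm{Sort}_n(\mathfrak{s}_{1\underline{23}})=\mathrm{Av}_n(132,3214,4213)$.
   Context: Permutations are words; a pattern is a permutation $\sigma\in\mathfrak S_k$ in which some blocks of consecutive entries may be underlined. A sequence $w$ of distinct numbers contains $\sigma$ if it has a subsequence order-isomorphic to $\sigma$ such that entries of the subsequence corresponding to entries of $\sigma$ that lie in a common underlined block occupy adjacent positions of $w$; otherwise $w$ avoids $\sigma$. $\mathrm{Av}_n(\sigma_1,\dots,\sigma_r)$ is the set of $\tau\in\mathfrak S_n$ avoiding every $\sigma_i$. Pattern-avoiding stack map $\mathfrak{s}_\sigma$: given input $\tau=\tau_1\cdots\tau_n$, process $\tau_1,\dots,\tau_n$ in order; when $\tau_i$ is next, as long as the stack is nonempty and the sequence formed by placing $\tau_i$ on top of the current stack, read from top to bottom, contains $\sigma$ (with underlined entries required to be adjacent in the stack), pop the top entry of the stack and append it to the output; then push $\tau_i$. After the input is exhausted, pop the remaining entries in order (top to bottom) and append them to the output. The output is $\mathfrak{s}_\sigma(\tau)$. West's stack-sorting map $s$ is the map that pushes each input entry onto a stack after first popping (to the output) all stack entries smaller than it, and empties the stack at the end. $\mathrm{Sort}_n(\mathfrak{s}_\sigma)$ is the set of $\tau\in\mathfrak S_n$ with $s(\mathfrak{s}_\sigma(\tau))=12\cdots n$ (equivalently, $\mathfrak{s}_\sigma(\tau)$ avoids $231$). -}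

module Defs where

open import Data.Nat using (ℕ; zero; suc; _<_)
open import Data.Bool using (Bool)
open import Data.List using (List; []; _∷_; length; _++_; map; upTo)
open import Data.List.Membership.Propositional using (_∈_)
open import Data.List.Relation.Unary.All using (All)
open import Data.Product using (Σ; _×_; ∃)
open import Relation.Nullary using (¬_)
open import Relation.Binary.PropositionalEquality using (_≡_)
open import Function.Bundles using (_⇔_)

-- 0-based list access with default value 0 (only used at in-range indices)
at : List ℕ → ℕ → ℕ
at []       _       = 0
at (x ∷ xs) zero    = x
at (x ∷ xs) (suc i) = at xs i

-- A (partially underlined) pattern: the permutation sigma (as a list of its
-- entries) and the list of 0-based indices j such that entries j and j+1 of
-- sigma lie in a common underlined block.
record Pattern : Set where
  constructor pat
  field
    perm  : List ℕ
    links : List ℕ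
open Pattern public

Contains : Pattern → List ℕ → Set
Contains σ w =
  Σ (List ℕ) λ is →
    (length is ≡ length (perm σ))
  × All (_< length w) is
  × (∀ a → suc a < length is → at is a < at is (suc a))
  × (∀ a b → a < length is → b < length is →
        (at w (at is a) < at w (at is b)) ⇔ (at (perm σ) a < at (perm σ) b))
  × (∀ j → j ∈ links σ → suc (at is j) ≡ at is (suc j))

Avoids : Pattern → List ℕ → Set
Avoids σ w = ¬ Contains σ w

classical : List ℕ → Pattern
classical p = pat p []

IsPerm : ℕ → List ℕ → Set
IsPerm n τ = τ ↭ map suc (upTo n)
  where open import Data.List.Relation.Binary.Permutation.Propositional using (_↭_)

-- Stacks are lists with the top of the stack at the head.
-- Push σ x s s' out : inserting next input entry x into stack s pops the
-- entries out (in order) and leaves stack s' (with x on top).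
data Push (σ : Pattern) (x : ℕ) : List ℕ → List ℕ → List ℕ → Set where
  push-empty : Push σ x [] (x ∷ []) []
  push-stop  : ∀ {y s} → ¬ Contains σ (x ∷ y ∷ s) →
               Push σ x (y ∷ s) (x ∷ y ∷ s) []
  push-pop   : ∀ {y s s' out} → Contains σ (x ∷ y ∷ s) →
               Push σ x s s' out → Push σ x (y ∷ s) s' (y ∷ out)

-- Run σ input stack output : processing the remaining input from the given
-- stack produces output (the final stack is emptied top to bottom).
data Run (σ : Pattern) : List ℕ → List ℕ → List ℕ → Set where
  run-done : ∀ {s} → Run σ [] s s
  run-step : ∀ {x τ s s' o o'} → Push σ x s s' o → Run σ τ s' o' →
             Run σ (x ∷ τ) s (o ++ o')

StackMap : Pattern → List ℕ → List ℕ → Set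
StackMap σ τ out = Run σ τ [] out

Sortable : Pattern → List ℕ → Set
Sortable σ τ = ∃ λ out → StackMap σ τ out × Avoids (classical (2 ∷ 3 ∷ 1 ∷ [])) out

-- the pattern 1 underline(23): entries 1 and 2 (0-based) form a block
p1-23 : Pattern
p1-23 = pat (1 ∷ 2 ∷ 3 ∷ []) (1 ∷ [])

{-# OPTIONS --safe #-}

-- While the prefix π read so far avoids 132, 3214
-- and 4213, the machine has one of two shapes: either π is increasing and lies
-- reversed on the stack, or π = R₂ ++ M ++ R₁ with R₂ the first and R₁ the
-- current ascending run of π, the stack holds reverse R₁ on top of reverse R₂,
-- and the output so far is M rearranged decreasingly. In both shapes the output
-- followed by the stack avoids 231. The next entry x creates a 3214 or a 4213
-- exactly when it exceeds the middle entry of some 321 of π, and the invariant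
-- makes this equivalent to x exceeding an entry already output. Comparing x
-- with the output, R₁ and R₂ therefore either preserves the shape or exhibits
-- both a forbidden pattern in π x and a 231 in the output followed by the new
-- stack. That 231 persists, since the final output contains the current output
-- followed by the current stack as a subsequence.
module Submission where

open import Defs
open import Level using (0ℓ)
open import Data.Nat using (ℕ; zero; suc; pred; _<_; _≤_; _>_; z≤n; s≤s; s<s⁻¹; _<?_; _≤?_)
open import Data.Nat.Properties
  using (suc-injective; <-trans; <-asym; <-irrefl; <-cmp; ≤-refl; <⇒≤; <-≤-trans; ≤-<-trans; n<1+n)
open import Data.List using (List; []; _∷_; [_]; _++_; length; map; reverse)
open import Data.List.Properties
  using (length-map; map-∘; ++-assoc; ++-identityʳ; ∷-injective; ∷ʳ-injective; unfold-reverse)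
open import Data.List.Membership.Propositional using (_∈_; _∉_)
open import Data.List.Membership.Propositional.Properties using (∈-++⁺ˡ; ∈-++⁺ʳ; ∈-++⁻)
open import Data.List.Relation.Unary.Any using (here; there)
import Data.List.Relation.Unary.Any.Properties as Any
open import Data.List.Relation.Unary.All as All using (All; []; _∷_)
import Data.List.Relation.Unary.All.Properties as All
open import Data.List.Relation.Unary.AllPairs using (AllPairs; []; _∷_)
import Data.List.Relation.Unary.AllPairs.Properties as AllPairs
open import Data.List.Relation.Unary.Linked as Linked using (Linked; []; [-]; _∷_)
open import Data.List.Relation.Unary.Linked.Properties as Linkedₚ using (Linked⇒AllPairs)
open import Data.List.Relation.Unary.Unique.Propositional using (Unique)
import Data.List.Relation.Unary.Unique.Propositional.Properties as Unique
open import Data.List.Relation.Binary.Sublist.Propositional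
  using (_⊆_; []; _∷_; _∷ʳ_; minimum; from∈; to∈; ⊆-refl; ⊆-trans)
open import Data.List.Relation.Binary.Sublist.Propositional.Properties
  using (All-resp-⊆; ++⁺; ++⁺ˡ; ++⁺ʳ; ∷ˡ⁻; reverse⁺)
open import Data.List.Relation.Binary.Permutation.Propositional using (_↭_; ↭-refl; ↭-sym; ↭⇒↭ₛ)
open import Data.List.Relation.Binary.Permutation.Propositional.Properties as ↭
  using (∈-resp-↭; ↭-reverse)
open import Data.List.Relation.Binary.Permutation.Setoid.Properties using (Unique-resp-↭)
open import Data.Product using (∃; ∃₂; _×_; _,_)
open import Data.Sum using (_⊎_; inj₁; inj₂)
open import Data.Empty using (⊥; ⊥-elim)
open import Function using (_∘_; case_of_; _⇔_; mk⇔; Equivalence)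
open import Relation.Nullary using (¬_; Dec; yes; no)
open import Relation.Nullary.Decidable using (True; toWitness; _×-dec_)
open import Relation.Binary.Core using (Rel)
open import Relation.Binary.Definitions using (tri<; tri≈; tri>)
open import Relation.Binary.PropositionalEquality
  using (_≡_; refl; sym; trans; cong; subst; module ≡-Reasoning)
open import Relation.Binary.PropositionalEquality.Properties using (setoid)

private
  variable
    R : Rel ℕ 0ℓ
    b d m x y u v : ℕ
    xs ys zs vs w π D : List ℕ

-- Sublists and ordered lists

Descending : List ℕ → Set
Descending = AllPairs _>_

AllPairs-pair : AllPairs R xs → u ∷ v ∷ [] ⊆ xs → R u v
AllPairs-pair (_ ∷ rs) (_ ∷ʳ s)   = AllPairs-pair rs s
AllPairs-pair (r ∷ _)  (refl ∷ s) = All.lookup r (to∈ s)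

AllPairs-resp-⊆ : xs ⊆ ys → AllPairs R ys → AllPairs R xs
AllPairs-resp-⊆ []         []       = []
AllPairs-resp-⊆ (_ ∷ʳ s)   (_ ∷ rs) = AllPairs-resp-⊆ s rs
AllPairs-resp-⊆ (refl ∷ s) (r ∷ rs) = All-resp-⊆ s r ∷ AllPairs-resp-⊆ s rs

unique-asym : Unique xs → u ∷ v ∷ [] ⊆ xs → v ∷ u ∷ [] ⊆ xs → ⊥
unique-asym (_ ∷ un)       (_ ∷ʳ p)   (_ ∷ʳ q)   = unique-asym un p q
unique-asym (distinct ∷ _) (_ ∷ʳ p)   (refl ∷ _) = All.lookup distinct (to∈ (∷ˡ⁻ p)) refl
unique-asym (distinct ∷ _) (refl ∷ _) (_ ∷ʳ q)   = All.lookup distinct (to∈ (∷ˡ⁻ q)) refl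
unique-asym (distinct ∷ _) (refl ∷ p) (refl ∷ _) = All.lookup distinct (to∈ p) refl

unique-∷ʳ⇒∉ : Unique (xs ++ [ x ]) → x ∉ xs
unique-∷ʳ⇒∉ un x∈ = AllPairs-pair un (++⁺ (from∈ x∈) ⊆-refl) refl

descending-pair : Descending D → u ∈ D → v ∈ D → v < u → u ∷ v ∷ [] ⊆ D
descending-pair _           (here refl) (here refl) v<u = ⊥-elim (<-irrefl refl v<u)
descending-pair _           (here refl) (there v∈)  _   = refl ∷ from∈ v∈
descending-pair (above ∷ _) (there u∈)  (here refl) v<u = ⊥-elim (<-asym v<u (All.lookup above u∈))
descending-pair (_ ∷ d)     (there u∈)  (there v∈)  v<u = _ ∷ʳ descending-pair d u∈ v∈ v<u

ascending-in-reverse : Descending D → u ∈ D → v ∈ D → u < v → u ∷ v ∷ [] ⊆ reverse D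
ascending-in-reverse d u∈ v∈ u<v = reverse⁺ (descending-pair d v∈ u∈ u<v)

descending-insert : Descending (xs ++ ys) → All (x <_) xs → All (_< x) ys → Descending (xs ++ x ∷ ys)
descending-insert {[]}     d           []             below = below ∷ d
descending-insert {z ∷ xs} (above ∷ d) (x<z ∷ xs>x) below =
  All.++⁺ (All.++⁻ˡ xs above) (x<z ∷ All.++⁻ʳ xs above) ∷ descending-insert d xs>x below

descending-∷ʳ : Descending xs → All (x <_) xs → Descending (xs ++ [ x ])
descending-∷ʳ d above = AllPairs.++⁺ d ([] ∷ []) (All.map (_∷ []) above)

descending-++ : Descending (xs ++ ys) → u ∈ xs → v ∈ ys → v < u
descending-++ d u∈ v∈ = AllPairs-pair d (++⁺ (from∈ u∈) (from∈ v∈))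

descending-last : Descending (xs ++ [ m ]) → u ∈ xs ++ [ m ] → m ≤ u
descending-last {xs} d u∈ with ∈-++⁻ xs u∈
... | inj₁ u∈xs        = <⇒≤ (descending-++ d u∈xs (here refl))
... | inj₂ (here refl) = ≤-refl

⊆-++⁻ : ∀ xs → ys ⊆ xs ++ zs → ∃₂ λ ys₁ ys₂ → ys ≡ ys₁ ++ ys₂ × ys₁ ⊆ xs × ys₂ ⊆ zs
⊆-++⁻ []       s = [] , _ , refl , [] , s
⊆-++⁻ (x ∷ xs) (_ ∷ʳ s) with ⊆-++⁻ xs s
... | ys₁ , ys₂ , eq , s₁ , s₂ = ys₁ , ys₂ , eq , x ∷ʳ s₁ , s₂
⊆-++⁻ (x ∷ xs) (refl ∷ s) with ⊆-++⁻ xs s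
... | ys₁ , ys₂ , refl , s₁ , s₂ = x ∷ ys₁ , ys₂ , refl , refl ∷ s₁ , s₂

⊆-∷ʳ⁻ : ∀ ys → ys ++ [ y ] ⊆ π ++ [ x ] → ys ++ [ y ] ⊆ π ⊎ (y ≡ x × ys ⊆ π)
⊆-∷ʳ⁻ {π = π} ys s with ⊆-++⁻ π s
... | ys₁ , [] , eq , s₁ , _ ∷ʳ [] =
  inj₁ (subst (_⊆ π) (sym (trans eq (++-identityʳ ys₁))) s₁)
... | ys₁ , _ ∷ [] , eq , s₁ , refl ∷ [] with ∷ʳ-injective ys ys₁ eq
...   | refl , refl = inj₂ (refl , s₁)

Straddles : List ℕ → ℕ → Set
Straddles D b = ∃₂ λ a c → a ∈ D × c ∈ D × a < b × b < c

all-below-or-above : ∀ x D → x ∉ D → All (_< x) D ⊎ ∃ λ v → v ∈ D × x < v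
all-below-or-above x []      _  = inj₁ []
all-below-or-above x (y ∷ D) x∉ with <-cmp y x | all-below-or-above x D (x∉ ∘ there)
... | tri< y<x _ _  | inj₁ below           = inj₁ (y<x ∷ below)
... | tri< _ _ _    | inj₂ (v , v∈ , x<v)  = inj₂ (v , there v∈ , x<v)
... | tri≈ _ refl _ | _                    = ⊥-elim (x∉ (here refl))
... | tri> _ _ x<y  | _                    = inj₂ (y , here refl , x<y)

all-above-or-below : ∀ x D → x ∉ D → All (x <_) D ⊎ ∃ λ v → v ∈ D × v < x
all-above-or-below x []      _  = inj₁ []
all-above-or-below x (y ∷ D) x∉ with <-cmp x y | all-above-or-below x D (x∉ ∘ there)
... | tri< x<y _ _  | inj₁ above           = inj₁ (x<y ∷ above)
... | tri< _ _ _    | inj₂ (v , v∈ , v<x)  = inj₂ (v , there v∈ , v<x)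
... | tri≈ _ refl _ | _                    = ⊥-elim (x∉ (here refl))
... | tri> _ _ y<x  | _                    = inj₂ (y , here refl , y<x)

compare-with : ∀ x D → x ∉ D → All (_< x) D ⊎ All (x <_) D ⊎ Straddles D x
compare-with x D x∉ with all-below-or-above x D x∉ | all-above-or-below x D x∉
... | inj₁ below          | _                   = inj₁ below
... | inj₂ _              | inj₁ above          = inj₂ (inj₁ above)
... | inj₂ (c , c∈ , x<c) | inj₂ (a , a∈ , a<x) = inj₂ (inj₂ (a , c , a∈ , c∈ , a<x , x<c))

straddles? : ∀ x D → x ∉ D → Dec (Straddles D x)
straddles? x D x∉ with compare-with x D x∉
... | inj₁ below         = no λ (_ , _ , _ , c∈ , _ , x<c) → <-asym x<c (All.lookup below c∈)
... | inj₂ (inj₁ above)  = no λ (_ , _ , a∈ , _ , a<x , _) → <-asym a<x (All.lookup above a∈)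
... | inj₂ (inj₂ between) = yes between

-- Positions and occurrences

at-map : ∀ (f : ℕ → ℕ) xs {i} → i < length xs → at (map f xs) i ≡ f (at xs i)
at-map f (x ∷ xs) {zero}  _       = refl
at-map f (x ∷ xs) {suc i} (s≤s p) = at-map f xs p

All-at : ∀ {P : ℕ → Set} {i} → All P xs → i < length xs → P (at xs i)
All-at {i = zero}  (p ∷ _)  _       = p
All-at {i = suc i} (_ ∷ ps) (s≤s q) = All-at ps q

AllPairs-at : ∀ {i j} → AllPairs R xs → i < j → j < length xs → R (at xs i) (at xs j)
AllPairs-at {i = zero}  {suc j} (r ∷ _)  _       (s≤s q) = All-at r q
AllPairs-at {i = suc i} {suc j} (_ ∷ rs) (s≤s p) (s≤s q) = AllPairs-at rs p q

linked⇒adjacent : Linked R xs → ∀ i → suc i < length xs → R (at xs i) (at xs (suc i))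
linked⇒adjacent (r ∷ _)  zero    _       = r
linked⇒adjacent (_ ∷ rs) (suc i) (s≤s p) = linked⇒adjacent rs i p
linked⇒adjacent [-]      _       (s≤s ())

adjacent⇒linked : ∀ xs → (∀ i → suc i < length xs → R (at xs i) (at xs (suc i))) → Linked R xs
adjacent⇒linked []           _ = []
adjacent⇒linked (x ∷ [])     _ = [-]
adjacent⇒linked (x ∷ y ∷ xs) r =
  r 0 (s≤s (s≤s z≤n)) ∷ adjacent⇒linked (y ∷ xs) (λ i p → r (suc i) (s≤s p))

strictly-increasing : Linked _<_ xs → ∀ {i j} → i < j → j < length xs → at xs i < at xs j
strictly-increasing l = AllPairs-at (Linked⇒AllPairs <-trans l)

private
  shift-linked⁺ : Linked _<_ xs → Linked _<_ (map suc xs)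
  shift-linked⁺ l = Linkedₚ.map⁺ (Linked.map s≤s l)

  shift-linked⁻ : Linked _<_ (map suc xs) → Linked _<_ xs
  shift-linked⁻ l = Linked.map s<s⁻¹ (Linkedₚ.map⁻ l)

  shift-bounded⁻ : ∀ {n} → All (_< suc n) (map suc xs) → All (_< n) xs
  shift-bounded⁻ bs = All.map s<s⁻¹ (All.map⁻ bs)

  positive⇒shifted : All (0 <_) xs → ∃ λ ys → xs ≡ map suc ys
  positive⇒shifted []              = [] , refl
  positive⇒shifted (s≤s z≤n ∷ ps) with positive⇒shifted ps
  ... | ys , refl = _ ∷ ys , refl

  linked-above-head : Linked _<_ (x ∷ xs) → All (x <_) xs
  linked-above-head l with Linked⇒AllPairs <-trans l
  ... | above ∷ _ = above

  at-shifted : ∀ y w xs → map (at (y ∷ w)) (map suc xs) ≡ map (at w) xs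
  at-shifted y w xs = sym (map-∘ xs)

indices⇒⊆ : ∀ w is → All (_< length w) is → Linked _<_ is → map (at w) is ⊆ w
indices⇒⊆ []      []       _        _ = []
indices⇒⊆ []      (_ ∷ _)  (() ∷ _) _
indices⇒⊆ (y ∷ w) []       _        _ = minimum _
indices⇒⊆ (y ∷ w) (zero ∷ is) (_ ∷ bs) l
  with positive⇒shifted (linked-above-head l)
... | js , refl = refl ∷ shifted⊆ y w js bs (Linked.tail l)
  where
  shifted⊆ : ∀ y w js → All (_< suc (length w)) (map suc js) → Linked _<_ (map suc js) →
             map (at (y ∷ w)) (map suc js) ⊆ w
  shifted⊆ y w js bs l =
    subst (_⊆ w) (sym (at-shifted y w js)) (indices⇒⊆ w js (shift-bounded⁻ bs) (shift-linked⁻ l))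
indices⇒⊆ (y ∷ w) (suc i ∷ is) bs l
  with positive⇒shifted (All.map (<-trans (s≤s z≤n)) (linked-above-head l))
... | js , refl =
  y ∷ʳ subst (_⊆ w) (sym (at-shifted y w (i ∷ js)))
               (indices⇒⊆ w (i ∷ js) (shift-bounded⁻ bs) (shift-linked⁻ l))

⊆⇒indices : vs ⊆ w → ∃ λ is → All (_< length w) is × Linked _<_ is × map (at w) is ≡ vs
⊆⇒indices [] = [] , [] , [] , refl
⊆⇒indices {w = y ∷ w} (y ∷ʳ s) with ⊆⇒indices s
... | is , bs , l , eq =
  map suc is , All.map⁺ (All.map s≤s bs) , shift-linked⁺ l , trans (at-shifted y w is) eq
⊆⇒indices {w = y ∷ w} (refl ∷ s) with ⊆⇒indices s
... | is , bs , l , eq =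
  zero ∷ map suc is , s≤s z≤n ∷ All.map⁺ (All.map s≤s bs) , zero-linked is l ,
  cong (y ∷_) (trans (at-shifted y w is) eq)
  where
  zero-linked : ∀ is → Linked _<_ is → Linked _<_ (zero ∷ map suc is)
  zero-linked []       _ = [-]
  zero-linked (i ∷ is) l = s≤s z≤n ∷ shift-linked⁺ l

InRange : ℕ → ℕ → Set
InRange k i = 0 < i × i ≤ k

inRange? : ∀ k i → Dec (InRange k i)
inRange? k i = (0 <? i) ×-dec (i ≤? k)

rank-embedding : ∀ {vals i j} → Linked _<_ vals →
                 InRange (length vals) i → InRange (length vals) j →
                 (at vals (pred i) < at vals (pred j)) ⇔ (i < j)
rank-embedding {vals} {suc i} {suc j} l (_ , i≤) (_ , j≤) =
  mk⇔ reflect (λ i<j → strictly-increasing l (s<s⁻¹ i<j) j≤)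
  where
  reflect : at vals i < at vals j → suc i < suc j
  reflect lt with <-cmp i j
  ... | tri< i<j _ _ = s≤s i<j
  ... | tri≈ _ refl _ = ⊥-elim (<-irrefl refl lt)
  ... | tri> _ _ j<i = ⊥-elim (<-asym lt (strictly-increasing l j<i i≤))

-- vals lists the entries of w at the positions is in increasing order, so the
-- entry playing the role of the pattern value i (counted from 1) is at vals (pred i).
contains-at : ∀ σ w is vals → All (_< length w) is → Linked _<_ is → Linked _<_ vals →
              {_ : True (All.all? (inRange? (length vals)) (perm σ))} →
              map (at w) is ≡ map (at vals ∘ pred) (perm σ) →
              (∀ j → j ∈ links σ → suc (at is j) ≡ at is (suc j)) → Contains σ w
contains-at σ w is vals bounded increasing sorted {in-range} eq linked =
  is , same-length , bounded , linked⇒adjacent increasing , order , linked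
  where
  p : List ℕ
  p = perm σ
  same-length : length is ≡ length p
  same-length = trans (sym (length-map (at w) is)) (trans (cong length eq) (length-map _ p))
  entry : ∀ {a} → a < length is → at w (at is a) ≡ at vals (pred (at p a))
  entry {a} a< = trans (sym (at-map (at w) is a<))
                       (trans (cong (λ l → at l a) eq) (at-map _ p (subst (a <_) same-length a<)))
  ranked : ∀ {a} → a < length is → InRange (length vals) (at p a)
  ranked a< = All-at (toWitness in-range) (subst (_ <_) same-length a<)
  order : ∀ a b → a < length is → b < length is →
          (at w (at is a) < at w (at is b)) ⇔ (at p a < at p b)
  order a b a< b< rewrite entry a< | entry b< = rank-embedding sorted (ranked a<) (ranked b<)

contains-classical : ∀ p vals → Linked _<_ vals → {_ : True (All.all? (inRange? (length vals)) p)} →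
                     map (at vals ∘ pred) p ⊆ w → Contains (classical p) w
contains-classical {w} p vals sorted {in-range} sub with ⊆⇒indices sub
... | is , bounded , increasing , eq =
  contains-at (classical p) w is vals bounded increasing sorted {in-range} eq (λ _ ())

-- The patterns

data Has231 (w : List ℕ) : Set where
  has231 : ∀ {a b c} → b ∷ c ∷ a ∷ [] ⊆ w → a < b → b < c → Has231 w

data Forbidden (w : List ℕ) : Set where
  has132  : ∀ {a b c}   → a ∷ c ∷ b ∷ [] ⊆ w → a < b → b < c → Forbidden w
  has3214 : ∀ {a b c d} → c ∷ b ∷ a ∷ d ∷ [] ⊆ w → a < b → b < c → c < d → Forbidden w
  has4213 : ∀ {a b c d} → d ∷ b ∷ a ∷ c ∷ [] ⊆ w → a < b → b < c → c < d → Forbidden w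

private
  evident : ∀ {m n} {_ : True (m <? n)} → m < n
  evident {_} {_} {t} = toWitness t

  from-pattern : ∀ {A : Set} {m n} → A ⇔ (m < n) → {_ : True (m <? n)} → A
  from-pattern e {t} = Equivalence.from e (toWitness t)

has231⇒contains : Has231 w → Contains (classical (2 ∷ 3 ∷ 1 ∷ [])) w
has231⇒contains (has231 {a} {b} {c} sub a<b b<c) =
  contains-classical _ (a ∷ b ∷ c ∷ []) (a<b ∷ b<c ∷ [-]) sub

contains⇒has231 : Contains (classical (2 ∷ 3 ∷ 1 ∷ [])) w → Has231 w
contains⇒has231 (_ ∷ _ ∷ _ ∷ [] , _ , bounded , increasing , order , _) =
  has231 (indices⇒⊆ _ _ bounded (adjacent⇒linked _ increasing))
         (from-pattern (order 2 0 evident evident)) (from-pattern (order 0 1 evident evident))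
contains⇒has231 ([] , () , _)
contains⇒has231 (_ ∷ [] , () , _)
contains⇒has231 (_ ∷ _ ∷ [] , () , _)
contains⇒has231 (_ ∷ _ ∷ _ ∷ _ ∷ _ , () , _)

Avoids-132-3214-4213 : List ℕ → Set
Avoids-132-3214-4213 w = Avoids (classical (1 ∷ 3 ∷ 2 ∷ [])) w
                       × Avoids (classical (3 ∷ 2 ∷ 1 ∷ 4 ∷ [])) w
                       × Avoids (classical (4 ∷ 2 ∷ 1 ∷ 3 ∷ [])) w

¬forbidden⇔avoids : (¬ Forbidden w) ⇔ Avoids-132-3214-4213 w
¬forbidden⇔avoids = mk⇔ (λ ok → ok ∘ from132 , ok ∘ from3214 , ok ∘ from4213) to-contains
  where
  to-contains : Avoids-132-3214-4213 w → ¬ Forbidden w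
  to-contains (no132 , _ , _) (has132 {a} {b} {c} sub a<b b<c) =
    no132 (contains-classical _ (a ∷ b ∷ c ∷ []) (a<b ∷ b<c ∷ [-]) sub)
  to-contains (_ , no3214 , _) (has3214 {a} {b} {c} {d} sub a<b b<c c<d) =
    no3214 (contains-classical _ (a ∷ b ∷ c ∷ d ∷ []) (a<b ∷ b<c ∷ c<d ∷ [-]) sub)
  to-contains (_ , _ , no4213) (has4213 {a} {b} {c} {d} sub a<b b<c c<d) =
    no4213 (contains-classical _ (a ∷ b ∷ c ∷ d ∷ []) (a<b ∷ b<c ∷ c<d ∷ [-]) sub)

  from132 : Contains (classical (1 ∷ 3 ∷ 2 ∷ [])) w → Forbidden w
  from132 (_ ∷ _ ∷ _ ∷ [] , _ , bounded , increasing , order , _) =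
    has132 (indices⇒⊆ _ _ bounded (adjacent⇒linked _ increasing))
           (from-pattern (order 0 2 evident evident)) (from-pattern (order 2 1 evident evident))
  from132 ([] , () , _)
  from132 (_ ∷ [] , () , _)
  from132 (_ ∷ _ ∷ [] , () , _)
  from132 (_ ∷ _ ∷ _ ∷ _ ∷ _ , () , _)

  from3214 : Contains (classical (3 ∷ 2 ∷ 1 ∷ 4 ∷ [])) w → Forbidden w
  from3214 (_ ∷ _ ∷ _ ∷ _ ∷ [] , _ , bounded , increasing , order , _) =
    has3214 (indices⇒⊆ _ _ bounded (adjacent⇒linked _ increasing))
            (from-pattern (order 2 1 evident evident)) (from-pattern (order 1 0 evident evident))
            (from-pattern (order 0 3 evident evident))
  from3214 ([] , () , _)
  from3214 (_ ∷ [] , () , _)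
  from3214 (_ ∷ _ ∷ [] , () , _)
  from3214 (_ ∷ _ ∷ _ ∷ [] , () , _)
  from3214 (_ ∷ _ ∷ _ ∷ _ ∷ _ ∷ _ , () , _)

  from4213 : Contains (classical (4 ∷ 2 ∷ 1 ∷ 3 ∷ [])) w → Forbidden w
  from4213 (_ ∷ _ ∷ _ ∷ _ ∷ [] , _ , bounded , increasing , order , _) =
    has4213 (indices⇒⊆ _ _ bounded (adjacent⇒linked _ increasing))
            (from-pattern (order 2 1 evident evident)) (from-pattern (order 1 3 evident evident))
            (from-pattern (order 3 0 evident evident))
  from4213 ([] , () , _)
  from4213 (_ ∷ [] , () , _)
  from4213 (_ ∷ _ ∷ [] , () , _)
  from4213 (_ ∷ _ ∷ _ ∷ [] , () , _)
  from4213 (_ ∷ _ ∷ _ ∷ _ ∷ _ ∷ _ , () , _)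

data AscentAbove (u : ℕ) : List ℕ → Set where
  here  : ∀ {y z r} → u < y → y < z → AscentAbove u (y ∷ z ∷ r)
  there : ∀ {y r} → AscentAbove u r → AscentAbove u (y ∷ r)

data Has1-23 : List ℕ → Set where
  here  : ∀ {u r} → AscentAbove u r → Has1-23 (u ∷ r)
  there : ∀ {u r} → Has1-23 r → Has1-23 (u ∷ r)

private
  ascent-at : ∀ r j → suc j < length r → u < at r j → at r j < at r (suc j) → AscentAbove u r
  ascent-at (y ∷ z ∷ r) zero    _       p q = here p q
  ascent-at (y ∷ r)     (suc j) (s≤s b) p q = there (ascent-at r j b p q)
  ascent-at (y ∷ [])    zero    (s≤s ()) _ _

  has1-23-at : ∀ w {i j} → i < j → suc j < length w →
               at w i < at w j → at w j < at w (suc j) → Has1-23 w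
  has1-23-at (u ∷ r) {zero}  {suc j} _         (s≤s b) p q = here (ascent-at r j b p q)
  has1-23-at (u ∷ r) {suc i} {suc j} (s≤s i<j) (s≤s b) p q = there (has1-23-at r i<j b p q)

  ascent-position : AscentAbove u w → ∃ λ j → suc j < length w × u < at w j × at w j < at w (suc j)
  ascent-position (here p q) = 0 , s≤s (s≤s z≤n) , p , q
  ascent-position (there a) with ascent-position a
  ... | j , b , p , q = suc j , s≤s b , p , q

  has1-23-positions : Has1-23 w →
    ∃₂ λ i j → i < j × suc j < length w × at w i < at w j × at w j < at w (suc j)
  has1-23-positions (here a) with ascent-position a
  ... | j , b , p , q = 0 , suc j , s≤s z≤n , s≤s b , p , q
  has1-23-positions (there h) with has1-23-positions h
  ... | i , j , i<j , b , p , q = suc i , suc j , s≤s i<j , s≤s b , p , q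

contains⇒has1-23 : Contains p1-23 w → Has1-23 w
contains⇒has1-23 (_ ∷ _ ∷ _ ∷ [] , _ , _ ∷ _ ∷ k< ∷ [] , increasing , order , adjacent)
  with adjacent 1 (here refl)
... | refl = has1-23-at _ (increasing 0 evident) k<
               (from-pattern (order 0 1 evident evident)) (from-pattern (order 1 2 evident evident))
contains⇒has1-23 ([] , () , _)
contains⇒has1-23 (_ ∷ [] , () , _)
contains⇒has1-23 (_ ∷ _ ∷ [] , () , _)
contains⇒has1-23 (_ ∷ _ ∷ _ ∷ _ ∷ _ , () , _)

has1-23⇒contains : Has1-23 w → Contains p1-23 w
has1-23⇒contains {w} h with has1-23-positions h
... | i , j , i<j , b , p , q =
  contains-at p1-23 w (i ∷ j ∷ suc j ∷ []) (at w i ∷ at w j ∷ at w (suc j) ∷ [])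
    (<-trans i<j j< ∷ j< ∷ b ∷ []) (i<j ∷ n<1+n j ∷ [-]) (p ∷ q ∷ [-]) refl adjacent
  where
  j< : j < length w
  j< = <-trans (n<1+n j) b
  adjacent : ∀ k → k ∈ 1 ∷ [] →
             suc (at (i ∷ j ∷ suc j ∷ []) k) ≡ at (i ∷ j ∷ suc j ∷ []) (suc k)
  adjacent _ (here refl) = refl

has231-resp-⊆ : xs ⊆ ys → Has231 xs → Has231 ys
has231-resp-⊆ s (has231 sub a<b b<c) = has231 (⊆-trans sub s) a<b b<c

forbidden-resp-⊆ : xs ⊆ ys → Forbidden xs → Forbidden ys
forbidden-resp-⊆ s (has132 sub a<b b<c)      = has132 (⊆-trans sub s) a<b b<c
forbidden-resp-⊆ s (has3214 sub a<b b<c c<d) = has3214 (⊆-trans sub s) a<b b<c c<d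
forbidden-resp-⊆ s (has4213 sub a<b b<c c<d) = has4213 (⊆-trans sub s) a<b b<c c<d

no231-++ : Descending xs → Descending ys → All (¬_ ∘ Straddles ys) xs → ¬ Has231 (xs ++ ys)
no231-++ {xs} dxs dys unstraddled (has231 sub a<b b<c) with ⊆-++⁻ xs sub
... | [] , _ , refl , _ , s₂ = <-asym b<c (AllPairs-pair dys (⊆-trans (++⁺ʳ _ ⊆-refl) s₂))
... | _ ∷ [] , _ , refl , s₁ , s₂ =
  All.lookup unstraddled (to∈ s₁) (_ , _ , to∈ (∷ˡ⁻ s₂) , to∈ s₂ , a<b , b<c)
... | _ ∷ _ ∷ _ , _ , eq , s₁ , _ with ∷-injective eq
...   | refl , eq′ with ∷-injective eq′
...     | refl , _ = <-asym b<c (AllPairs-pair dxs (⊆-trans (++⁺ʳ _ ⊆-refl) s₁))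

Completes132 : List ℕ → ℕ → Set
Completes132 π x = ∃₂ λ a c → a ∷ c ∷ [] ⊆ π × a < x × x < c

Middle321 : List ℕ → ℕ → Set
Middle321 π b = ∃₂ λ d a → d ∷ b ∷ a ∷ [] ⊆ π × a < b × b < d

middle321-resp-⊆ : xs ⊆ ys → Middle321 xs b → Middle321 ys b
middle321-resp-⊆ s (d , a , sub , a<b , b<d) = d , a , ⊆-trans sub s , a<b , b<d

middle321-∷ʳ⁻ : Middle321 (π ++ [ x ]) b →
                Middle321 π b ⊎ (x < b × ∃ λ d → d ∷ b ∷ [] ⊆ π × b < d)
middle321-∷ʳ⁻ (d , a , sub , a<b , b<d) with ⊆-∷ʳ⁻ (_ ∷ _ ∷ []) sub
... | inj₁ s        = inj₁ (d , a , s , a<b , b<d)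
... | inj₂ (refl , s) = inj₂ (a<b , d , s , b<d)

completes132⇒forbidden : Completes132 π x → Forbidden (π ++ [ x ])
completes132⇒forbidden (_ , _ , s , a<x , x<c) = has132 (++⁺ s ⊆-refl) a<x x<c

middle-below⇒forbidden : x ∉ π → Middle321 π b → b < x → Forbidden (π ++ [ x ])
middle-below⇒forbidden {x = x} x∉π (d , a , s , a<b , b<d) b<x with <-cmp d x
... | tri< d<x _ _  = has3214 (++⁺ s ⊆-refl) a<b b<d d<x
... | tri≈ _ refl _ = ⊥-elim (x∉π (to∈ s))
... | tri> _ _ x<d  = has4213 (++⁺ s ⊆-refl) a<b b<x x<d

SafeExtension : List ℕ → ℕ → Set
SafeExtension π x = ¬ Completes132 π x × (∀ {b} → Middle321 π b → ¬ b < x)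

forbidden-∷ʳ⁻ : SafeExtension π x → Forbidden (π ++ [ x ]) → Forbidden π
forbidden-∷ʳ⁻ (no132 , _) (has132 sub a<b b<c) with ⊆-∷ʳ⁻ (_ ∷ _ ∷ []) sub
... | inj₁ s          = has132 s a<b b<c
... | inj₂ (refl , s) = ⊥-elim (no132 (_ , _ , s , a<b , b<c))
forbidden-∷ʳ⁻ (_ , no321) (has3214 sub a<b b<c c<d) with ⊆-∷ʳ⁻ (_ ∷ _ ∷ _ ∷ []) sub
... | inj₁ s          = has3214 s a<b b<c c<d
... | inj₂ (refl , s) = ⊥-elim (no321 (_ , _ , s , a<b , b<c) (<-trans b<c c<d))
forbidden-∷ʳ⁻ (_ , no321) (has4213 sub a<b b<c c<d) with ⊆-∷ʳ⁻ (_ ∷ _ ∷ _ ∷ []) sub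
... | inj₁ s          = has4213 s a<b b<c c<d
... | inj₂ (refl , s) = ⊥-elim (no321 (_ , _ , s , a<b , <-trans b<c c<d) b<c)

-- The stack machine

push-deterministic : ∀ {σ S S₁ S₂ p₁ p₂} → Push σ x S S₁ p₁ → Push σ x S S₂ p₂ →
                     S₁ ≡ S₂ × p₁ ≡ p₂
push-deterministic push-empty     push-empty     = refl , refl
push-deterministic (push-stop _)  (push-stop _)  = refl , refl
push-deterministic (push-stop ¬c) (push-pop c _) = ⊥-elim (¬c c)
push-deterministic (push-pop c _) (push-stop ¬c) = ⊥-elim (¬c c)
push-deterministic (push-pop _ p) (push-pop _ q) with push-deterministic p q
... | refl , refl = refl , refl

push-shape : ∀ {σ S S' p} → Push σ x S S' p → ∃ λ R → S ≡ p ++ R × S' ≡ x ∷ R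
push-shape push-empty    = [] , refl , refl
push-shape (push-stop _) = _ , refl , refl
push-shape (push-pop _ p) with push-shape p
... | R , refl , refl = R , refl , refl

run-keeps-stack : ∀ {σ r S o} → Run σ r S o → S ⊆ o
run-keeps-stack run-done = ⊆-refl
run-keeps-stack (run-step push run) with push-shape push
... | _ , refl , refl = ++⁺ ⊆-refl (∷ˡ⁻ (run-keeps-stack run))

push-without-pop : ∀ {S} → ¬ Has1-23 (x ∷ S) → Push p1-23 x S (x ∷ S) []
push-without-pop {S = []}    _  = push-empty
push-without-pop {S = _ ∷ _} ¬h = push-stop (¬h ∘ contains⇒has1-23)

descending-no-ascent : Descending D → ¬ AscentAbove u D
descending-no-ascent ((z<y ∷ _) ∷ _) (here _ y<z) = <-asym y<z z<y
descending-no-ascent (_ ∷ d)         (there a)    = descending-no-ascent d a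

descending-no-1-23 : Descending D → ¬ Has1-23 D
descending-no-1-23 (_ ∷ d) (here a)  = descending-no-ascent d a
descending-no-1-23 (_ ∷ d) (there h) = descending-no-1-23 d h

push-on-descending : Descending D → Push p1-23 x D (x ∷ D) []
push-on-descending d = push-without-pop λ
  { (here a)  → descending-no-ascent d a
  ; (there h) → descending-no-1-23 d h }

-- On a stack (F ++ [ m ]) ++ D made of two descending runs the only ascent is m < head D.
ascent-below-run : ∀ F → Descending (F ++ [ m ]) → Descending D →
                   AscentAbove u ((F ++ [ m ]) ++ D) → u < m
ascent-below-run []          _                 _  (here u<m _) = u<m
ascent-below-run []          _                 dD (there a)    = ⊥-elim (descending-no-ascent dD a)
ascent-below-run (f ∷ [])    ((m<f ∷ _) ∷ _)   _  (here _ f<m) = ⊥-elim (<-asym f<m m<f)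
ascent-below-run (f ∷ g ∷ F) ((g<f ∷ _) ∷ _)   _  (here _ f<g) = ⊥-elim (<-asym f<g g<f)
ascent-below-run (f ∷ F)     (_ ∷ dF)          dD (there a)    = ascent-below-run F dF dD a

no-1-23-on-runs : ∀ F → Descending (F ++ [ m ]) → Descending D → ¬ Has1-23 ((F ++ [ m ]) ++ D)
no-1-23-on-runs []      _            dD (here a)  = descending-no-ascent dD a
no-1-23-on-runs []      _            dD (there h) = descending-no-1-23 dD h
no-1-23-on-runs (f ∷ F) (above ∷ dF) dD (here a)  =
  <-asym (ascent-below-run F dF dD a) (All.lookup above (∈-++⁺ʳ F (here refl)))
no-1-23-on-runs (f ∷ F) (_ ∷ dF)     dD (there h) = no-1-23-on-runs F dF dD h

push-above-run : ∀ F → m < x → Descending (F ++ [ m ]) → Descending D →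
                 Push p1-23 x ((F ++ [ m ]) ++ D) (x ∷ (F ++ [ m ]) ++ D) []
push-above-run F m<x dF dD = push-without-pop λ
  { (here a)  → <-asym m<x (ascent-below-run F dF dD a)
  ; (there h) → no-1-23-on-runs F dF dD h }

pop-run : ∀ F {h T} → x < m → m < h → Descending (h ∷ T) →
          Push p1-23 x ((F ++ [ m ]) ++ h ∷ T) (x ∷ h ∷ T) (F ++ [ m ])
pop-run []      x<m m<h d = push-pop (has1-23⇒contains (here (here x<m m<h))) (push-on-descending d)
pop-run {x = x} {m = m} (f ∷ F) {h} {T} x<m m<h d =
  push-pop (has1-23⇒contains (here (there (ascent-at-junction F)))) (pop-run F x<m m<h d)
  where
  ascent-at-junction : ∀ G → AscentAbove x ((G ++ [ m ]) ++ h ∷ T)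
  ascent-at-junction []      = here x<m m<h
  ascent-at-junction (_ ∷ G) = there (ascent-at-junction G)

-- The stack is D₁ ++ D₂, where D₁ and D₂ hold the current and the first
-- ascending run of π, reversed; O, the output so far, rearranges the entries
-- of π between the two runs.
record Invariant (π O D₁ D₂ : List ℕ) : Set where
  field
    between             : List ℕ
    layout              : π ≡ reverse D₂ ++ between ++ reverse D₁
    between↭output      : between ↭ O
    descending₁         : Descending (O ++ D₁)
    descending₂         : Descending D₂
    output-above-middle : ∀ {u} → u ∈ O → ∃ λ b → Middle321 π b × b ≤ u
    middle-above-output : ∀ {b} → Middle321 π b → ∃ λ u → u ∈ O × u ≤ b
    unstraddled         : All (¬_ ∘ Straddles D₂) (O ++ D₁)

data State (π : List ℕ) : List ℕ → List ℕ → Set where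
  ascending : π ≡ reverse D → Descending D → State π [] D
  split     : ∀ {O F₁ m₁ h₂ T₂} → m₁ < h₂ → (O ≡ [] ⊎ ∃ λ w → w ∈ O × w < h₂) →
              Invariant π O (F₁ ++ [ m₁ ]) (h₂ ∷ T₂) →
              State π O ((F₁ ++ [ m₁ ]) ++ h₂ ∷ T₂)

module Layout {π O D₁ D₂} (I : Invariant π O D₁ D₂) (unique : Unique π) where
  open Invariant I

  private
    in-π : xs ⊆ reverse D₂ ++ between ++ reverse D₁ → xs ⊆ π
    in-π = subst (_ ⊆_) (sym layout)

    in-between : u ∈ O → u ∈ between
    in-between = ∈-resp-↭ (↭-sym between↭output)

  descending-D₁ : Descending D₁
  descending-D₁ = AllPairs-resp-⊆ (++⁺ˡ O ⊆-refl) descending₁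

  ∈π⁻ : y ∈ π → y ∈ D₂ ⊎ y ∈ O ⊎ y ∈ D₁
  ∈π⁻ y∈ with ∈-++⁻ (reverse D₂) (subst (_ ∈_) layout y∈)
  ... | inj₁ y∈D₂ = inj₁ (Any.reverse⁻ y∈D₂)
  ... | inj₂ y∈ with ∈-++⁻ between y∈
  ...   | inj₁ y∈between = inj₂ (inj₁ (∈-resp-↭ between↭output y∈between))
  ...   | inj₂ y∈D₁     = inj₂ (inj₂ (Any.reverse⁻ y∈D₁))

  D₂⊆π : u ∈ D₂ → u ∈ π
  D₂⊆π u∈ = to∈ (in-π (++⁺ʳ _ (from∈ (Any.reverse⁺ u∈))))

  O⊆π : u ∈ O → u ∈ π
  O⊆π u∈ = to∈ (in-π (++⁺ˡ (reverse D₂) (++⁺ʳ _ (from∈ (in-between u∈)))))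

  D₁⊆π : u ∈ D₁ → u ∈ π
  D₁⊆π u∈ = to∈ (in-π (++⁺ˡ (reverse D₂) (++⁺ˡ between (from∈ (Any.reverse⁺ u∈)))))

  D₂-before-O : u ∈ D₂ → v ∈ O → u ∷ v ∷ [] ⊆ π
  D₂-before-O u∈ v∈ =
    in-π (++⁺ (from∈ (Any.reverse⁺ u∈)) (from∈ (∈-++⁺ˡ (in-between v∈))))

  D₂-before-D₁ : u ∈ D₂ → v ∈ D₁ → u ∷ v ∷ [] ⊆ π
  D₂-before-D₁ u∈ v∈ =
    in-π (++⁺ (from∈ (Any.reverse⁺ u∈)) (from∈ (∈-++⁺ʳ between (Any.reverse⁺ v∈))))

  O-before-D₁ : u ∈ O → v ∈ D₁ → u ∷ v ∷ [] ⊆ π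
  O-before-D₁ u∈ v∈ =
    in-π (++⁺ˡ (reverse D₂) (++⁺ (from∈ (in-between u∈)) (from∈ (Any.reverse⁺ v∈))))

  D₁-ascending : u ∈ D₁ → v ∈ D₁ → u < v → u ∷ v ∷ [] ⊆ π
  D₁-ascending u∈ v∈ u<v =
    in-π (++⁺ˡ (reverse D₂) (++⁺ˡ between (ascending-in-reverse descending-D₁ u∈ v∈ u<v)))

  D₂-ascending : u ∈ D₂ → v ∈ D₂ → u < v → u ∷ v ∷ [] ⊆ π
  D₂-ascending u∈ v∈ u<v = in-π (++⁺ʳ _ (ascending-in-reverse descending₂ u∈ v∈ u<v))

  no-inversion-onto-D₂ : b ∈ D₂ → d ∷ b ∷ [] ⊆ π → b < d → ⊥
  no-inversion-onto-D₂ b∈ s b<d with ∈π⁻ (to∈ s)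
  ... | inj₁ d∈D₂        = unique-asym unique s (D₂-ascending b∈ d∈D₂ b<d)
  ... | inj₂ (inj₁ d∈O)  = unique-asym unique s (D₂-before-O b∈ d∈O)
  ... | inj₂ (inj₂ d∈D₁) = unique-asym unique s (D₂-before-D₁ b∈ d∈D₁)

data Step (π : List ℕ) (x : ℕ) (O S : List ℕ) : Set where
  continue : ∀ {S' p} → Push p1-23 x S S' p → State (π ++ [ x ]) (O ++ p) S' → SafeExtension π x →
             Step π x O S
  fail     : ∀ {S' p} → Push p1-23 x S S' p → Has231 (O ++ p ++ S') → Forbidden (π ++ [ x ]) →
             Step π x O S

module Read (π : List ℕ) (x : ℕ) (unique : Unique (π ++ [ x ])) where

  private
    x∉π : x ∉ π
    x∉π = unique-∷ʳ⇒∉ unique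

    π⊆ : π ⊆ π ++ [ x ]
    π⊆ = ++⁺ʳ _ ⊆-refl

    unique-π : Unique π
    unique-π = AllPairs-resp-⊆ π⊆ unique

  module Ascending {D} (layout : π ≡ reverse D) (desc : Descending D) where

    ∈D⇒∈π : u ∈ D → u ∈ π
    ∈D⇒∈π u∈ = subst (_ ∈_) (sym layout) (Any.reverse⁺ u∈)

    ∈π⇒∈D : u ∈ π → u ∈ D
    ∈π⇒∈D u∈ = Any.reverse⁻ (subst (_ ∈_) layout u∈)

    no-inversion : d ∷ b ∷ [] ⊆ π → b < d → ⊥
    no-inversion s b<d = unique-asym unique-π s (subst (_ ⊆_) (sym layout)
      (ascending-in-reverse desc (∈π⇒∈D (to∈ (∷ˡ⁻ s))) (∈π⇒∈D (to∈ s)) b<d))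

    no-middle : ¬ Middle321 π b
    no-middle (_ , _ , s , _ , b<d) = no-inversion (⊆-trans (++⁺ʳ _ ⊆-refl) s) b<d

    no-middle-∷ʳ : ¬ Middle321 (π ++ [ x ]) b
    no-middle-∷ʳ mid with middle321-∷ʳ⁻ mid
    ... | inj₁ old               = no-middle old
    ... | inj₂ (_ , _ , s , b<d) = no-inversion s b<d

    keep-ascending : All (_< x) D → Step π x [] D
    keep-ascending below =
      continue (push-on-descending desc)
               (ascending (trans (cong (_++ [ x ]) layout) (sym (unfold-reverse x D))) (below ∷ desc))
               ((λ (_ , _ , s , _ , x<c) → <-asym x<c (All.lookup below (∈π⇒∈D (to∈ (∷ˡ⁻ s))))) ,
                λ mid _ → no-middle mid)

    start-split : ∀ {h T} → D ≡ h ∷ T → All (x <_) D → Step π x [] D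
    start-split refl above =
      continue (push-on-descending desc) (split {F₁ = []} (All.head above) (inj₁ refl) invariant)
               ((λ (_ , _ , s , a<x , _) → <-asym a<x (All.lookup above (∈π⇒∈D (to∈ s)))) ,
                λ mid _ → no-middle mid)
      where
      invariant : Invariant (π ++ [ x ]) [] [ x ] D
      invariant = record
        { between             = []
        ; layout              = cong (_++ [ x ]) layout
        ; between↭output      = ↭-refl
        ; descending₁         = [] ∷ []
        ; descending₂         = desc
        ; output-above-middle = λ ()
        ; middle-above-output = ⊥-elim ∘ no-middle-∷ʳ
        ; unstraddled         = (λ (_ , _ , a∈ , _ , a<x , _) → <-asym a<x (All.lookup above a∈)) ∷ []
        }

    straddled : Straddles D x → Step π x [] D
    straddled (a , c , a∈ , c∈ , a<x , x<c) =
      fail (push-on-descending desc) (has231 (refl ∷ descending-pair desc c∈ a∈ a<c) a<x x<c)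
           (completes132⇒forbidden
             (a , c , subst (_ ⊆_) (sym layout) (ascending-in-reverse desc a∈ c∈ a<c) , a<x , x<c))
      where
      a<c : a < c
      a<c = <-trans a<x x<c

  ascending-step : π ≡ reverse D → Descending D → Step π x [] D
  ascending-step {[]}    layout desc = Ascending.keep-ascending layout desc []
  ascending-step {h ∷ T} layout desc with compare-with x (h ∷ T) (x∉π ∘ Ascending.∈D⇒∈π layout desc)
  ... | inj₁ below           = Ascending.keep-ascending layout desc below
  ... | inj₂ (inj₁ above)    = Ascending.start-split layout desc refl above
  ... | inj₂ (inj₂ straddle) = Ascending.straddled layout desc straddle

  module Split {O F₁ m₁ h₂ T₂} (m<h : m₁ < h₂) (low : O ≡ [] ⊎ ∃ λ w → w ∈ O × w < h₂)
               (I : Invariant π O (F₁ ++ [ m₁ ]) (h₂ ∷ T₂)) where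
    open Invariant I
    open Layout I unique-π

    D₁ D₂ : List ℕ
    D₁ = F₁ ++ [ m₁ ]
    D₂ = h₂ ∷ T₂

    m₁∈D₁ : m₁ ∈ D₁
    m₁∈D₁ = ∈-++⁺ʳ F₁ (here refl)

    m₁-below-O : u ∈ O → m₁ < u
    m₁-below-O u∈ = descending-++ descending₁ u∈ m₁∈D₁

    m₁-least : u ∈ O ++ D₁ → m₁ ≤ u
    m₁-least u∈ with ∈-++⁻ O u∈
    ... | inj₁ u∈O  = <⇒≤ (m₁-below-O u∈O)
    ... | inj₂ u∈D₁ = descending-last descending-D₁ u∈D₁

    new-middle : Middle321 (π ++ [ x ]) b → (∃ λ u → u ∈ O × u ≤ b) ⊎ (b ∈ D₁ × x < b)
    new-middle mid with middle321-∷ʳ⁻ mid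
    ... | inj₁ old = inj₁ (middle-above-output old)
    ... | inj₂ (x<b , _ , s , b<d) with ∈π⁻ (to∈ (∷ˡ⁻ s))
    ...   | inj₁ b∈D₂        = ⊥-elim (no-inversion-onto-D₂ b∈D₂ s b<d)
    ...   | inj₂ (inj₁ b∈O)  = inj₁ (_ , b∈O , ≤-refl)
    ...   | inj₂ (inj₂ b∈D₁) = inj₂ (b∈D₁ , x<b)

    old-middle : u ∈ O → ∃ λ b → Middle321 (π ++ [ x ]) b × b ≤ u
    old-middle u∈ with output-above-middle u∈
    ... | b , mid , b≤u = b , middle321-resp-⊆ π⊆ mid , b≤u

    -- x < m₁: the run D₁ is popped and x starts a new run on D₂.
    module Flush (x<m : x < m₁) (above-D₂ : All (x <_) D₂) where

      below-π : u ∈ π → x < u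
      below-π u∈ with ∈π⁻ u∈
      ... | inj₁ u∈D₂        = All.lookup above-D₂ u∈D₂
      ... | inj₂ (inj₁ u∈O)  = <-≤-trans x<m (m₁-least (∈-++⁺ˡ u∈O))
      ... | inj₂ (inj₂ u∈D₁) = <-≤-trans x<m (m₁-least (∈-++⁺ʳ O u∈D₁))

      safe : SafeExtension π x
      safe = (λ (_ , _ , s , a<x , _) → <-asym a<x (below-π (to∈ s))) ,
             (λ (_ , _ , s , _) b<x → <-asym b<x (below-π (to∈ (∷ˡ⁻ s))))

      invariant : Invariant (π ++ [ x ]) (O ++ D₁) [ x ] D₂
      invariant = record
        { between             = between ++ reverse D₁
        ; layout              = trans (cong (_++ [ x ]) layout)
                                      (++-assoc (reverse D₂) (between ++ reverse D₁) [ x ])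
        ; between↭output      = ↭.++⁺ between↭output (↭-reverse D₁)
        ; descending₁         = descending-∷ʳ descending₁ (All.tabulate (<-≤-trans x<m ∘ m₁-least))
        ; descending₂         = descending₂
        ; output-above-middle = output-above-middle′
        ; middle-above-output = middle-above-output′
        ; unstraddled         = All.++⁺ unstraddled
            ((λ (_ , _ , a∈ , _ , a<x , _) → <-asym a<x (All.lookup above-D₂ a∈)) ∷ [])
        }
        where
        output-above-middle′ : u ∈ O ++ D₁ → ∃ λ b → Middle321 (π ++ [ x ]) b × b ≤ u
        output-above-middle′ u∈ with ∈-++⁻ O u∈
        ... | inj₁ u∈O  = old-middle u∈O
        ... | inj₂ u∈D₁ = m₁ , (h₂ , x , ++⁺ (D₂-before-D₁ (here refl) m₁∈D₁) ⊆-refl , x<m , m<h) ,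
                          m₁-least (∈-++⁺ʳ O u∈D₁)
        middle-above-output′ : Middle321 (π ++ [ x ]) b → ∃ λ u → u ∈ O ++ D₁ × u ≤ b
        middle-above-output′ mid with new-middle mid
        ... | inj₁ (u , u∈O , u≤b) = u , ∈-++⁺ˡ u∈O , u≤b
        ... | inj₂ (b∈D₁ , _)      = _ , ∈-++⁺ʳ O b∈D₁ , ≤-refl

    flush-step : x < m₁ → Step π x O (D₁ ++ D₂)
    flush-step x<m with all-above-or-below x D₂ (x∉π ∘ D₂⊆π)
    ... | inj₁ above-D₂ =
      continue (pop-run F₁ x<m m<h descending₂)
               (split {F₁ = []} (<-trans x<m m<h) (inj₂ (m₁ , ∈-++⁺ʳ O m₁∈D₁ , m<h))
                      (Flush.invariant x<m above-D₂))
               (Flush.safe x<m above-D₂)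
    ... | inj₂ (e , e∈ , e<x) =
      fail (pop-run F₁ x<m m<h descending₂)
           (has231 (++⁺ˡ O (++⁺ˡ D₁ (refl ∷ descending-pair descending₂ (here refl) e∈ e<h))) e<x x<h)
           (completes132⇒forbidden (e , h₂ , D₂-ascending e∈ (here refl) e<h , e<x , x<h))
      where
      x<h : x < h₂
      x<h = <-trans x<m m<h
      e<h : e < h₂
      e<h = <-trans e<x x<h

    -- m₁ < x: x is pushed onto the run D₁.
    module Stack (above-D₁ : All (_< x) D₁) (below-O : All (x <_) O)
                 (x-unstraddled : ¬ Straddles D₂ x) where

      below-h₂ : u ∈ O → x < h₂
      below-h₂ u∈ = from-low low
        where
        from-low : O ≡ [] ⊎ ∃ (λ w → w ∈ O × w < h₂) → x < h₂
        from-low (inj₁ O≡[])          = case subst (_ ∈_) O≡[] u∈ of λ ()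
        from-low (inj₂ (w , w∈ , w<h)) = <-trans (All.lookup below-O w∈) w<h

      no132 : ¬ Completes132 π x
      no132 (a , c , s , a<x , x<c) with ∈π⁻ (to∈ s) | ∈π⁻ (to∈ (∷ˡ⁻ s))
      ... | _                | inj₂ (inj₂ c∈D₁) = <-asym x<c (All.lookup above-D₁ c∈D₁)
      ... | inj₂ (inj₁ a∈O)  | _                = <-asym a<x (All.lookup below-O a∈O)
      ... | inj₂ (inj₂ a∈D₁) | inj₂ (inj₁ c∈O)  = unique-asym unique-π s (O-before-D₁ c∈O a∈D₁)
      ... | inj₂ (inj₂ a∈D₁) | inj₁ c∈D₂        = unique-asym unique-π s (D₂-before-D₁ c∈D₂ a∈D₁)
      ... | inj₁ a∈D₂        | inj₁ c∈D₂        = x-unstraddled (a , c , a∈D₂ , c∈D₂ , a<x , x<c)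
      ... | inj₁ a∈D₂        | inj₂ (inj₁ c∈O)  =
        x-unstraddled (a , h₂ , a∈D₂ , here refl , a<x , below-h₂ c∈O)

      safe : SafeExtension π x
      safe = no132 , λ mid b<x → let (_ , u∈O , u≤b) = middle-above-output mid
                                 in <-asym b<x (<-≤-trans (All.lookup below-O u∈O) u≤b)

      invariant : Invariant (π ++ [ x ]) O (x ∷ D₁) D₂
      invariant = record
        { between             = between
        ; layout              = layout′
        ; between↭output      = between↭output
        ; descending₁         = descending-insert descending₁ below-O above-D₁
        ; descending₂         = descending₂
        ; output-above-middle = old-middle
        ; middle-above-output = middle-above-output′
        ; unstraddled         = All.++⁺ (All.++⁻ˡ O unstraddled)
                                        (x-unstraddled ∷ All.++⁻ʳ O unstraddled)
        }
        where
        open ≡-Reasoning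
        layout′ : π ++ [ x ] ≡ reverse D₂ ++ between ++ reverse (x ∷ D₁)
        layout′ = begin
          π ++ [ x ]
            ≡⟨ cong (_++ [ x ]) layout ⟩
          (reverse D₂ ++ between ++ reverse D₁) ++ [ x ]
            ≡⟨ ++-assoc (reverse D₂) _ [ x ] ⟩
          reverse D₂ ++ (between ++ reverse D₁) ++ [ x ]
            ≡⟨ cong (reverse D₂ ++_) (++-assoc between _ [ x ]) ⟩
          reverse D₂ ++ between ++ reverse D₁ ++ [ x ]
            ≡⟨ cong (λ r → reverse D₂ ++ between ++ r) (unfold-reverse x D₁) ⟨
          reverse D₂ ++ between ++ reverse (x ∷ D₁)
            ∎
        middle-above-output′ : Middle321 (π ++ [ x ]) b → ∃ λ u → u ∈ O × u ≤ b
        middle-above-output′ mid with new-middle mid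
        ... | inj₁ bounded      = bounded
        ... | inj₂ (b∈D₁ , x<b) = ⊥-elim (<-asym x<b (All.lookup above-D₁ b∈D₁))

    stack-push : m₁ < x → Push p1-23 x (D₁ ++ D₂) (x ∷ D₁ ++ D₂) []
    stack-push m<x = push-above-run F₁ m<x descending-D₁ descending₂

    stack-step : m₁ < x → Step π x O (D₁ ++ D₂)
    stack-step m<x with all-below-or-above x D₁ (x∉π ∘ D₁⊆π)
    ... | inj₂ (v , v∈ , x<v) =
      fail (stack-push m<x)
           (has231 (++⁺ˡ O (refl ∷ ++⁺ʳ D₂ (descending-pair descending-D₁ v∈ m₁∈D₁ m<v))) m<x x<v)
           (completes132⇒forbidden (m₁ , v , D₁-ascending m₁∈D₁ v∈ m<v , m<x , x<v))
      where
      m<v : m₁ < v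
      m<v = <-trans m<x x<v
    ... | inj₁ above-D₁ with all-above-or-below x O (x∉π ∘ O⊆π)
    ...   | inj₂ (w , w∈ , w<x) =
      let (_ , mid , b≤w) = output-above-middle w∈ in
      fail (stack-push m<x)
           (has231 (++⁺ (from∈ w∈) (refl ∷ from∈ (∈-++⁺ˡ m₁∈D₁))) (m₁-below-O w∈) w<x)
           (middle-below⇒forbidden x∉π mid (≤-<-trans b≤w w<x))
    ...   | inj₁ below-O with straddles? x D₂ (x∉π ∘ D₂⊆π)
    ...     | yes (a , c , a∈ , c∈ , a<x , x<c) =
      fail (stack-push m<x)
           (has231 (++⁺ˡ O (refl ∷ ++⁺ˡ D₁ (descending-pair descending₂ c∈ a∈ a<c))) a<x x<c)
           (completes132⇒forbidden (a , c , D₂-ascending a∈ c∈ a<c , a<x , x<c))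
      where
      a<c : a < c
      a<c = <-trans a<x x<c
    ...     | no x-unstraddled =
      continue (stack-push m<x)
               (subst (λ O′ → State _ O′ _) (sym (++-identityʳ O))
                      (split {F₁ = x ∷ F₁} m<h low (Stack.invariant above-D₁ below-O x-unstraddled)))
               (Stack.safe above-D₁ below-O x-unstraddled)

  split-step : ∀ {O F₁ m₁ h₂ T₂} → m₁ < h₂ → (O ≡ [] ⊎ ∃ λ w → w ∈ O × w < h₂) →
               Invariant π O (F₁ ++ [ m₁ ]) (h₂ ∷ T₂) →
               Step π x O ((F₁ ++ [ m₁ ]) ++ h₂ ∷ T₂)
  split-step {m₁ = m₁} m<h low I with <-cmp x m₁
  ... | tri< x<m _ _  = Split.flush-step m<h low I x<m
  ... | tri≈ _ refl _ = ⊥-elim (x∉π (Layout.D₁⊆π I unique-π (∈-++⁺ʳ _ (here refl))))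
  ... | tri> _ _ m<x  = Split.stack-step m<h low I m<x

step : ∀ {π O S} → State π O S → Unique (π ++ [ x ]) → Step π x O S
step (ascending layout desc) unique = Read.ascending-step _ _ unique layout desc
step (split m<h low I)       unique = Read.split-step _ _ unique m<h low I

output++stack-avoids-231 : ∀ {π O S} → State π O S → ¬ Has231 (O ++ S)
output++stack-avoids-231 (ascending _ desc) = no231-++ [] desc []
output++stack-avoids-231 {O = O} (split {F₁ = F₁} {m₁} {h₂} {T₂} _ _ I) =
  no231-++ descending₁ descending₂ unstraddled
  ∘ subst Has231 (sym (++-assoc O (F₁ ++ [ m₁ ]) (h₂ ∷ T₂)))
  where open Invariant I

-- Running the machine

private
  prefix : ∀ π rest → π ++ [ x ] ⊆ π ++ x ∷ rest
  prefix π rest = ++⁺ ⊆-refl (refl ∷ minimum rest)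

  regroup : ∀ π rest → π ++ x ∷ rest ≡ (π ++ [ x ]) ++ rest
  regroup π rest = sym (++-assoc π [ _ ] rest)

sorts-if-avoids : ∀ {π O S} rest → State π O S → Unique (π ++ rest) → ¬ Forbidden (π ++ rest) →
               ∃ λ o → Run p1-23 rest S o × ¬ Has231 (O ++ o)
sorts-if-avoids []                 st _      _  = _ , run-done , output++stack-avoids-231 st
sorts-if-avoids {π} {O} (x ∷ rest) st unique ok with step st (AllPairs-resp-⊆ (prefix π rest) unique)
... | fail _ _ forbidden = ⊥-elim (ok (forbidden-resp-⊆ (prefix π rest) forbidden))
... | continue {p = p} push st′ _
  with sorts-if-avoids rest st′ (subst Unique (regroup π rest) unique)
                               (ok ∘ subst Forbidden (sym (regroup π rest)))
...   | o , run , avoids = p ++ o , run-step push run , avoids ∘ subst Has231 (sym (++-assoc O p o))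

avoids-if-sorts : ∀ {π O S o} rest → State π O S → Unique (π ++ rest) → ¬ Forbidden π →
               Run p1-23 rest S o → ¬ Has231 (O ++ o) → ¬ Forbidden (π ++ rest)
avoids-if-sorts {π} [] _ _ ok run-done _ = subst (¬_ ∘ Forbidden) (sym (++-identityʳ π)) ok
avoids-if-sorts {π} {O} (x ∷ rest) st unique ok (run-step {o = p} {o' = o} push run) avoids
  with step st (AllPairs-resp-⊆ (prefix π rest) unique)
... | fail push′ has _ with push-deterministic push push′
...   | refl , refl =
  ⊥-elim (avoids (has231-resp-⊆ (++⁺ (⊆-refl {x = O}) (++⁺ (⊆-refl {x = p}) (run-keeps-stack run))) has))
avoids-if-sorts {π} {O} (x ∷ rest) st unique ok (run-step {o = p} {o' = o} push run) avoids
  | continue push′ st′ safe with push-deterministic push push′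
...   | refl , refl =
  subst (¬_ ∘ Forbidden) (sym (regroup π rest))
    (avoids-if-sorts rest st′ (subst Unique (regroup π rest) unique) (ok ∘ forbidden-∷ʳ⁻ safe) run
                  (avoids ∘ subst Has231 (++-assoc O p o)))

perm⇒unique : ∀ {n τ} → IsPerm n τ → Unique τ
perm⇒unique {n} τ↭ =
  Unique-resp-↭ (setoid ℕ) (↭⇒↭ₛ (↭-sym τ↭)) (Unique.map⁺ suc-injective (Unique.upTo⁺ n))

mainTheorem1 : (n : ℕ) → 1 ≤ n → (τ : List ℕ) → IsPerm n τ →
    Sortable p1-23 τ ⇔
      (Avoids (classical (1 ∷ 3 ∷ 2 ∷ [])) τ
       × Avoids (classical (3 ∷ 2 ∷ 1 ∷ 4 ∷ [])) τ
       × Avoids (classical (4 ∷ 2 ∷ 1 ∷ 3 ∷ [])) τ)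
mainTheorem1 n _ τ τ∈𝔖ₙ = mk⇔ avoids sortable
  where
  unique : Unique τ
  unique = perm⇒unique τ∈𝔖ₙ

  start : State [] [] []
  start = ascending refl []

  avoids : Sortable p1-23 τ → Avoids-132-3214-4213 τ
  avoids (_ , run , out-avoids-231) = Equivalence.to ¬forbidden⇔avoids
    (avoids-if-sorts τ start unique (λ { (has132 () _ _) ; (has3214 () _ _ _) ; (has4213 () _ _ _) })
                  run (out-avoids-231 ∘ has231⇒contains))

  sortable : Avoids-132-3214-4213 τ → Sortable p1-23 τ
  sortable τ-avoids with sorts-if-avoids τ start unique (Equivalence.from ¬forbidden⇔avoids τ-avoids)
  ... | out , run , out-avoids-231 = out , run , out-avoids-231 ∘ contains⇒has231
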